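{- For every integer $m\ge2$, $R_{C_m}(3,3,\dots,3)=3$ (with $m$ arguments).
   Context: $C_m\le S_m$ denotes the cyclic group generated by the $m$-cycle $(1\,2\,\cdots\,m)$. An $m$-edge-coloured complete graph is a complete graph with each edge coloured from $[m]=\{1,\dots,m\}$. For $\Gamma\le S_m$, $\pi\in\Gamma$ and a vertex $v$, switching at $v$ with $\pi$ recolours every edge incident with $v$ of colour $i$ to colour $\pi(i)$, leaving other edges unchanged. Two such graphs on the same vertex set are $\Gamma$-switch equivalent if one is obtained from the other by a finite sequence of switches. $K_t^{(i)}$ is a complete graph on $t$ vertices with all edges of colour $i$. $R_\Gamma(a_1,\dots,a_m)$ is the least $n$ such that every $m$-edge-coloured complete graph on $n$ vertices is $\Gamma$-switch equivalent to one containing, for some $i$, a copy of $K_{a_i}^{(i)}$. -}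

module Defs where

open import Data.Nat using (ℕ; zero; suc; _<_)
open import Data.Nat.DivMod using (_mod_)
open import Data.Fin using (Fin; toℕ; _≟_)
open import Data.Bool using (Bool; if_then_else_; _xor_)
open import Data.Product using (Σ; ∃; _×_; _,_)
open import Relation.Nullary using (¬_)
open import Relation.Nullary.Decidable using (⌊_⌋)
open import Relation.Binary.PropositionalEquality using (_≡_; _≢_)
open import Relation.Binary.Construct.Closure.ReflexiveTransitive using (Star)

-- Colours [m] are represented by Fin m (colour i+1 of the paper is Fin-index i).
-- An m-edge-coloured complete graph on vertex set Fin n: a colour for every
-- ordered pair, required to be symmetric; diagonal values are irrelevant.
Colouring : ℕ → ℕ → Set
Colouring n m = Fin n → Fin n → Fin m

Symmetric : ∀ {n m} → Colouring n m → Set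
Symmetric c = ∀ x y → c x y ≡ c y x

cyc : ∀ {m} → Fin m → Fin m
cyc {suc m} i = suc (toℕ i) mod suc m

iter : ∀ {m} → ℕ → (Fin m → Fin m) → Fin m → Fin m
iter zero    f i = i
iter (suc k) f i = f (iter k f i)

InCyclic : ∀ {m} → (Fin m → Fin m) → Set
InCyclic {m} π = ∃ λ k → ∀ i → π i ≡ iter k cyc i

switch : ∀ {n m} → Fin n → (Fin m → Fin m) → Colouring n m → Colouring n m
switch v π c x y =
  if ⌊ x ≟ v ⌋ xor ⌊ y ≟ v ⌋ then π (c x y) else c x y

SwitchStep : ∀ {n m} → Colouring n m → Colouring n m → Set
SwitchStep {n} {m} c c' =
  Σ (Fin n) λ v → Σ (Fin m → Fin m) λ π →
    InCyclic π × (∀ x y → x ≢ y → c' x y ≡ switch v π c x y)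

SwitchEquiv : ∀ {n m} → Colouring n m → Colouring n m → Set
SwitchEquiv = Star SwitchStep

HasMonoTriangle : ∀ {n m} → Colouring n m → Fin m → Set
HasMonoTriangle {n} c i =
  Σ (Fin n) λ a → Σ (Fin n) λ b → Σ (Fin n) λ d →
    a ≢ b × a ≢ d × b ≢ d × c a b ≡ i × c a d ≡ i × c b d ≡ i

RamseyProp : ℕ → ℕ → Set
RamseyProp m n =
  (c : Colouring n m) → Symmetric c →
    Σ (Colouring n m) λ c' → SwitchEquiv c c' × Σ (Fin m) λ i → HasMonoTriangle c' i

SwitchRamseyIs : ℕ → ℕ → Set
SwitchRamseyIs m r = RamseyProp m r × (∀ n → n < r → ¬ RamseyProp m n)

-- A switch at v with a power of the cycle rotates the colours of all edges at v by
-- the same amount, and C_m acts transitively on the colours. So on a triangle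
-- 0 1 2, a switch at 2 makes the colour of 12 equal to that of 01 (leaving 01
-- alone), and then a switch at 1 rotates 01 and 12 together onto the colour of 02
-- (leaving 02 alone). Fewer than three vertices carry no triangle at all.
module Submission where

open import Defs
open import Data.Nat using (ℕ; zero; suc; _+_; _∸_; _≤_; _<_; z≤n; s≤s)
open import Data.Nat.Properties using (m∸n+n≡m; <-trans; n<1+n; <⇒≤; <⇒≱)
open import Data.Nat.DivMod using (_%_; m<n⇒m%n≡m; n%n≡0)
open import Data.Fin using (Fin; toℕ)
open import Data.Fin.Properties using (toℕ-injective; toℕ-fromℕ<; toℕ<n)
open import Data.Product using (Σ; ∃; _×_; _,_; proj₁; proj₂)
open import Relation.Nullary using (¬_; contradiction)
open import Relation.Binary.PropositionalEquality
open import Relation.Binary.Construct.Closure.ReflexiveTransitive using (ε; _◅_)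

iter-+ : ∀ {m} k l (f : Fin m → Fin m) x → iter (k + l) f x ≡ iter k f (iter l f x)
iter-+ zero    l f x = refl
iter-+ (suc k) l f x = cong f (iter-+ k l f x)

toℕ-cyc : ∀ {m} (i : Fin (suc m)) → toℕ (cyc i) ≡ suc (toℕ i) % suc m
toℕ-cyc i = toℕ-fromℕ< _

toℕ-cyc^k-zero : ∀ {m} k → k < suc m → toℕ (iter k cyc (Fin.zero {m})) ≡ k
toℕ-cyc^k-zero zero    _   = refl
toℕ-cyc^k-zero {m} (suc k) k<1+m = begin
  toℕ (cyc (iter k cyc Fin.zero))        ≡⟨ toℕ-cyc (iter k cyc Fin.zero) ⟩
  suc (toℕ (iter k cyc Fin.zero)) % suc m ≡⟨ cong (λ x → suc x % suc m) (toℕ-cyc^k-zero k (<-trans (n<1+n k) k<1+m)) ⟩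
  suc k % suc m                          ≡⟨ m<n⇒m%n≡m k<1+m ⟩
  suc k                                  ∎
  where open ≡-Reasoning

cyc^toℕ-zero : ∀ {m} (j : Fin (suc m)) → iter (toℕ j) cyc Fin.zero ≡ j
cyc^toℕ-zero j = toℕ-injective (toℕ-cyc^k-zero (toℕ j) (toℕ<n j))

cyc^order-zero : ∀ {m} → iter (suc m) cyc (Fin.zero {m}) ≡ Fin.zero
cyc^order-zero {m} = toℕ-injective (begin
  toℕ (cyc (iter m cyc Fin.zero))          ≡⟨ toℕ-cyc (iter m cyc Fin.zero) ⟩
  suc (toℕ (iter m cyc Fin.zero)) % suc m ≡⟨ cong (λ x → suc x % suc m) (toℕ-cyc^k-zero m (n<1+n m)) ⟩
  suc m % suc m                           ≡⟨ n%n≡0 (suc m) ⟩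
  0                                       ∎)
  where open ≡-Reasoning

cyc^-to-zero : ∀ {m} (i : Fin (suc m)) → iter (suc m ∸ toℕ i) cyc i ≡ Fin.zero
cyc^-to-zero {m} i = begin
  iter (suc m ∸ toℕ i) cyc i                                ≡⟨ cong (iter (suc m ∸ toℕ i) cyc) (sym (cyc^toℕ-zero i)) ⟩
  iter (suc m ∸ toℕ i) cyc (iter (toℕ i) cyc Fin.zero)      ≡⟨ sym (iter-+ (suc m ∸ toℕ i) (toℕ i) cyc Fin.zero) ⟩
  iter (suc m ∸ toℕ i + toℕ i) cyc Fin.zero                 ≡⟨ cong (λ k → iter k cyc Fin.zero) (m∸n+n≡m (<⇒≤ (toℕ<n i))) ⟩
  iter (suc m) cyc Fin.zero                                 ≡⟨ cyc^order-zero ⟩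
  Fin.zero                                                  ∎
  where open ≡-Reasoning

cyc-transitive : ∀ {m} (i j : Fin (suc m)) → ∃ λ k → iter k cyc i ≡ j
cyc-transitive {m} i j = toℕ j + (suc m ∸ toℕ i) , (begin
  iter (toℕ j + (suc m ∸ toℕ i)) cyc i             ≡⟨ iter-+ (toℕ j) (suc m ∸ toℕ i) cyc i ⟩
  iter (toℕ j) cyc (iter (suc m ∸ toℕ i) cyc i)    ≡⟨ cong (iter (toℕ j) cyc) (cyc^-to-zero i) ⟩
  iter (toℕ j) cyc Fin.zero                        ≡⟨ cyc^toℕ-zero j ⟩
  j                                                ∎)
  where open ≡-Reasoning

switchStep-cyc^ : ∀ {n m} (v : Fin n) k (c : Colouring n m) → SwitchStep c (switch v (iter k cyc) c)
switchStep-cyc^ v k c = v , iter k cyc , (k , λ _ → refl) , λ _ _ _ → refl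

pattern 0F = Fin.zero
pattern 1F = Fin.suc Fin.zero
pattern 2F = Fin.suc (Fin.suc Fin.zero)

switchEquiv-monoTriangle : ∀ {n m} (c : Colouring (3 + n) (suc m)) →
  Σ (Colouring (3 + n) (suc m)) λ c' → SwitchEquiv c c' × Σ (Fin (suc m)) λ i → HasMonoTriangle c' i
switchEquiv-monoTriangle c =
  c₂ , switchStep-cyc^ 2F k c ◅ switchStep-cyc^ 1F l c₁ ◅ ε ,
  c₁ 0F 2F , 0F , 1F , 2F , (λ ()) , (λ ()) , (λ ()) , c₂01≡c₁02 , refl , c₂12≡c₁02
  where
  k = proj₁ (cyc-transitive (c 1F 2F) (c 0F 1F))
  c₁ = switch 2F (iter k cyc) c
  c₁12≡c₁01 : c₁ 1F 2F ≡ c₁ 0F 1F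
  c₁12≡c₁01 = proj₂ (cyc-transitive (c 1F 2F) (c 0F 1F))
  l = proj₁ (cyc-transitive (c₁ 0F 1F) (c₁ 0F 2F))
  c₂ = switch 1F (iter l cyc) c₁
  c₂01≡c₁02 : c₂ 0F 1F ≡ c₁ 0F 2F
  c₂01≡c₁02 = proj₂ (cyc-transitive (c₁ 0F 1F) (c₁ 0F 2F))
  c₂12≡c₁02 : c₂ 1F 2F ≡ c₁ 0F 2F
  c₂12≡c₁02 = trans (cong (iter l cyc) c₁12≡c₁01) c₂01≡c₁02

distinct³⇒3≤n : ∀ {n} (a b d : Fin n) → a ≢ b → a ≢ d → b ≢ d → 3 ≤ n
distinct³⇒3≤n {suc (suc (suc _))} _ _ _ _ _ _ = s≤s (s≤s (s≤s z≤n))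
distinct³⇒3≤n 0F 0F _  a≢b _   _   = contradiction refl a≢b
distinct³⇒3≤n 1F 1F _  a≢b _   _   = contradiction refl a≢b
distinct³⇒3≤n 0F _  0F _   a≢d _   = contradiction refl a≢d
distinct³⇒3≤n 1F _  1F _   a≢d _   = contradiction refl a≢d
distinct³⇒3≤n _  0F 0F _   _   b≢d = contradiction refl b≢d
distinct³⇒3≤n _  1F 1F _   _   b≢d = contradiction refl b≢d

hasMonoTriangle⇒3≤n : ∀ {n m} {c : Colouring n m} {i} → HasMonoTriangle c i → 3 ≤ n
hasMonoTriangle⇒3≤n (a , b , d , a≢b , a≢d , b≢d , _) = distinct³⇒3≤n a b d a≢b a≢d b≢d

ramseyProp-3+n : ∀ m n → RamseyProp (suc m) (3 + n)
ramseyProp-3+n m n c _ = switchEquiv-monoTriangle c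

¬ramseyProp-<3 : ∀ m n → n < 3 → ¬ RamseyProp (suc m) n
¬ramseyProp-<3 m n n<3 R with R (λ _ _ → Fin.zero) (λ _ _ → refl)
... | _ , _ , _ , triangle = <⇒≱ n<3 (hasMonoTriangle⇒3≤n triangle)

theorem17 : (m : ℕ) → 2 ≤ m → SwitchRamseyIs m 3
theorem17 (suc m) _ = ramseyProp-3+n m 0 , ¬ramseyProp-<3 m
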